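{- Let $k$ be a positive integer with \[k\notin\{2,3,6,7,8,9,12,15,16,17,18,19,31,32,33,34\}.\] Then there exists a permutation $\pi$ (of some rank $n\ge 1$) such that $\mathbf{1}\cdot\pi = k$.
   Context: A permutation of rank $n$ is a bijection $\pi:\{1,\dots,n\}\to\{1,\dots,n\}$, written $\pi_1\pi_2\cdots\pi_n$ with $\pi_i=\pi(i)$. The cosine of $\pi$ is $\mathbf{1}\cdot\pi=\sum_{i=1}^n i\,\pi(i)$, i.e. the dot product of $\pi$ (viewed as a vector) with the identity permutation $\mathbf{1}=12\cdots n$ of the same rank. -}

module Defs where

open import Data.Nat using (ℕ; suc; _*_)
open import Data.Fin using (Fin; toℕ)
open import Data.Fin.Permutation using (Permutation′; _⟨$⟩ʳ_)
open import Data.List using (map; allFin)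
open import Data.Nat.ListAction using (sum)

-- Positions and values are 1-based: Fin n element i stands for i+1.
-- cosine π = Σ_{i=1}^{n} i · π(i)
cosine : ∀ {n} → Permutation′ n → ℕ
cosine {n} π = sum (map (λ i → suc (toℕ i) * suc (toℕ (π ⟨$⟩ʳ i))) (allFin n))

data Exceptional : ℕ → Set where
  e2 : Exceptional 2
  e3 : Exceptional 3
  e6 : Exceptional 6
  e7 : Exceptional 7
  e8 : Exceptional 8
  e9 : Exceptional 9
  e12 : Exceptional 12
  e15 : Exceptional 15
  e16 : Exceptional 16
  e17 : Exceptional 17
  e18 : Exceptional 18
  e19 : Exceptional 19
  e31 : Exceptional 31
  e32 : Exceptional 32
  e33 : Exceptional 33
  e34 : Exceptional 34

-- Prepending a fixed point to a permutation of rank n adds (n+1)² to its cosine. Conjugating by the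
-- complement i ↦ n+1−i, which satisfies cos π + cos πᶜ = (n+1)·T(n) with T the triangular numbers,
-- turns this into: prepending the value n+1 adds T(n+1). So if the cosines of rank n fill an interval
-- [l, h] with l + T(n) ≤ h + 1, the two shifted copies make the cosines of rank n+1 fill
-- [l + T(n+1), h + (n+1)²]. From the eleven permutations of rank 4 with cosines 20, …, 30 it follows
-- that the cosines of rank n ≥ 5 fill [tetrahedral n, squarePyramidal n]; these intervals chain
-- together from 35 = tetrahedral 5 on, and below 35 the values are settled by explicit witnesses.

module Submission where

open import Defs
open import Data.Nat using (ℕ; zero; suc; _+_; _*_; _∸_; _≤_; _≥_; _≤?_; z≤n; s≤s; s≤s⁻¹; NonZero; >-nonZero⁻¹)
open import Data.Nat.Properties
open import Data.Nat.ListAction using (sum)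
open import Data.Nat.Tactic.RingSolver using (solve-∀)
open import Data.Fin using (Fin; toℕ; opposite; inject₁; fromℕ)
open import Data.Fin.Patterns using (0F; 1F; 2F; 3F)
open import Data.Fin.Properties using (opposite-prop; toℕ<n; toℕ-inject₁; toℕ-fromℕ)
open import Data.Fin.Permutation using (Permutation′; _⟨$⟩ʳ_; _∘ₚ_; id; lift₀; reverse; transpose)
open import Data.List using (tabulate; upTo; applyUpTo)
open import Data.List.Properties using (map-tabulate)
open import Data.List.Relation.Unary.All as All using (All; []; _∷_)
open import Data.List.Relation.Unary.All.Properties using (applyUpTo⁻; ++⁺)
open import Data.Product using (Σ; ∃-syntax; _×_; _,_)
open import Data.Empty using (⊥-elim)
open import Function using (_∘_)
open import Relation.Binary.PropositionalEquality
open import Relation.Nullary using (¬_; yes; no)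
open import Algebra.Properties.Semiring.Sum +-*-semiring
  using (sum-syntax; sum-cong-≗; sum-init-last; ∑-distrib-+; *-distribˡ-sum; sum-permute)
  renaming (sum to ∑)

⟦_⟧ : ∀ {n} → Fin n → ℕ
⟦ i ⟧ = suc (toℕ i)

triangle : ℕ → ℕ
triangle zero    = 0
triangle (suc n) = triangle n + suc n

tetrahedral : ℕ → ℕ
tetrahedral zero    = 0
tetrahedral (suc n) = tetrahedral n + triangle (suc n)

squarePyramidal : ℕ → ℕ
squarePyramidal zero    = 0
squarePyramidal (suc n) = squarePyramidal n + suc n * suc n

triangle-square : ∀ n → triangle n + triangle (suc n) ≡ suc n * suc n
triangle-square zero    = refl
triangle-square (suc n) = begin
  triangle (suc n) + triangle (suc (suc n))             ≡⟨ regroup (triangle n) n ⟩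
  triangle n + triangle (suc n) + (suc n + suc (suc n)) ≡⟨ cong (_+ (suc n + suc (suc n))) (triangle-square n) ⟩
  suc n * suc n + (suc n + suc (suc n))                 ≡⟨ expand n ⟩
  suc (suc n) * suc (suc n)                             ∎
  where
  open ≡-Reasoning
  regroup : ∀ t m → t + suc m + (t + suc m + suc (suc m)) ≡ t + (t + suc m) + (suc m + suc (suc m))
  regroup = solve-∀
  expand : ∀ m → suc m * suc m + (suc m + suc (suc m)) ≡ suc (suc m) * suc (suc m)
  expand = solve-∀

sum-tabulate : ∀ n (f : Fin n → ℕ) → sum (tabulate f) ≡ ∑[ i < n ] f i
sum-tabulate zero    f = refl
sum-tabulate (suc n) f = cong (f 0F +_) (sum-tabulate n (f ∘ Data.Fin.suc))

sum-indices : ∀ n → ∑[ i < n ] ⟦ i ⟧ ≡ triangle n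
sum-indices zero    = refl
sum-indices (suc n) = begin
  ∑[ i < suc n ] ⟦ i ⟧                              ≡⟨ sum-init-last ⟦_⟧ ⟩
  ∑[ i < n ] ⟦ inject₁ i ⟧ + ⟦ fromℕ n ⟧           ≡⟨ cong₂ _+_ (sum-cong-≗ {n} (λ i → cong suc (toℕ-inject₁ i))) (cong suc (toℕ-fromℕ n)) ⟩
  ∑[ i < n ] ⟦ i ⟧ + suc n                          ≡⟨ cong (_+ suc n) (sum-indices n) ⟩
  triangle (suc n)                                  ∎
  where open ≡-Reasoning

sum-permuted-indices : ∀ {n} (π : Permutation′ n) → ∑[ i < n ] ⟦ π ⟨$⟩ʳ i ⟧ ≡ triangle n
sum-permuted-indices {n} π = trans (sym (sum-permute ⟦_⟧ π)) (sum-indices n)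

cosine-∑ : ∀ {n} (π : Permutation′ n) → cosine π ≡ ∑[ i < n ] (⟦ i ⟧ * ⟦ π ⟨$⟩ʳ i ⟧)
cosine-∑ {n} π = trans (cong sum (map-tabulate (λ i → i) term)) (sum-tabulate n term)
  where
  term : Fin n → ℕ
  term i = ⟦ i ⟧ * ⟦ π ⟨$⟩ʳ i ⟧

cosine-lift₀ : ∀ {n} (π : Permutation′ n) → cosine (lift₀ π) ≡ cosine π + suc n * suc n
cosine-lift₀ {n} π = begin
  cosine (lift₀ π)
    ≡⟨ cosine-∑ (lift₀ π) ⟩
  1 + ∑[ i < n ] (suc ⟦ i ⟧ * suc ⟦ π ⟨$⟩ʳ i ⟧)
    ≡⟨ cong suc (sum-cong-≗ {n} λ i → expand ⟦ i ⟧ ⟦ π ⟨$⟩ʳ i ⟧) ⟩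
  1 + ∑[ i < n ] ((⟦ i ⟧ * ⟦ π ⟨$⟩ʳ i ⟧ + ⟦ π ⟨$⟩ʳ i ⟧) + suc ⟦ i ⟧)
    ≡⟨ cong suc (trans (∑-distrib-+ (λ i → w i + ⟦ π ⟨$⟩ʳ i ⟧) (λ i → suc ⟦ i ⟧))
                        (cong (_+ _) (∑-distrib-+ w (λ i → ⟦ π ⟨$⟩ʳ i ⟧)))) ⟩
  1 + ((∑[ i < n ] (⟦ i ⟧ * ⟦ π ⟨$⟩ʳ i ⟧) + ∑[ i < n ] ⟦ π ⟨$⟩ʳ i ⟧) + ∑[ i < n ] suc ⟦ i ⟧)
    ≡⟨ cong (λ x → 1 + (x + ∑[ i < n ] suc ⟦ i ⟧)) (cong₂ _+_ (sym (cosine-∑ π)) (sum-permuted-indices π)) ⟩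
  1 + ((cosine π + triangle n) + ∑[ i < n ] suc ⟦ i ⟧)
    ≡⟨ regroup (cosine π) (triangle n) _ ⟩
  cosine π + (triangle n + ∑[ i < suc n ] ⟦ i ⟧)
    ≡⟨ cong (λ x → cosine π + (triangle n + x)) (sum-indices (suc n)) ⟩
  cosine π + (triangle n + triangle (suc n))
    ≡⟨ cong (cosine π +_) (triangle-square n) ⟩
  cosine π + suc n * suc n
    ∎
  where
  open ≡-Reasoning
  w : Fin n → ℕ
  w i = ⟦ i ⟧ * ⟦ π ⟨$⟩ʳ i ⟧
  expand : ∀ a b → suc a * suc b ≡ (a * b + b) + suc a
  expand = solve-∀
  regroup : ∀ c t s → 1 + ((c + t) + s) ≡ c + (t + suc s)
  regroup = solve-∀

complement : ∀ {n} → Permutation′ n → Permutation′ n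
complement π = π ∘ₚ reverse

index-opposite : ∀ {n} (j : Fin n) → ⟦ opposite j ⟧ + ⟦ j ⟧ ≡ suc n
index-opposite {n} j = begin
  suc (toℕ (opposite j)) + ⟦ j ⟧ ≡⟨ cong (λ x → suc x + ⟦ j ⟧) (opposite-prop j) ⟩
  suc (n ∸ ⟦ j ⟧ + ⟦ j ⟧)        ≡⟨ cong suc (m∸n+n≡m (toℕ<n j)) ⟩
  suc n                          ∎
  where open ≡-Reasoning

cosine-complement : ∀ {n} (π : Permutation′ n) → cosine (complement π) + cosine π ≡ suc n * triangle n
cosine-complement {n} π = begin
  cosine (complement π) + cosine π
    ≡⟨ cong₂ _+_ (cosine-∑ (complement π)) (cosine-∑ π) ⟩
  ∑[ i < n ] (⟦ i ⟧ * ⟦ opposite (π ⟨$⟩ʳ i) ⟧) + ∑[ i < n ] (⟦ i ⟧ * ⟦ π ⟨$⟩ʳ i ⟧)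
    ≡⟨ ∑-distrib-+ (λ i → ⟦ i ⟧ * ⟦ opposite (π ⟨$⟩ʳ i) ⟧) (λ i → ⟦ i ⟧ * ⟦ π ⟨$⟩ʳ i ⟧) ⟨
  ∑[ i < n ] (⟦ i ⟧ * ⟦ opposite (π ⟨$⟩ʳ i) ⟧ + ⟦ i ⟧ * ⟦ π ⟨$⟩ʳ i ⟧)
    ≡⟨ sum-cong-≗ {n} pair-up ⟩
  ∑[ i < n ] (suc n * ⟦ i ⟧)
    ≡⟨ *-distribˡ-sum {n} (suc n) ⟦_⟧ ⟨
  suc n * ∑[ i < n ] ⟦ i ⟧
    ≡⟨ cong (suc n *_) (sum-indices n) ⟩
  suc n * triangle n
    ∎
  where
  open ≡-Reasoning
  pair-up : ∀ i → ⟦ i ⟧ * ⟦ opposite (π ⟨$⟩ʳ i) ⟧ + ⟦ i ⟧ * ⟦ π ⟨$⟩ʳ i ⟧ ≡ suc n * ⟦ i ⟧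
  pair-up i = begin
    ⟦ i ⟧ * ⟦ opposite (π ⟨$⟩ʳ i) ⟧ + ⟦ i ⟧ * ⟦ π ⟨$⟩ʳ i ⟧ ≡⟨ *-distribˡ-+ ⟦ i ⟧ ⟦ opposite (π ⟨$⟩ʳ i) ⟧ ⟦ π ⟨$⟩ʳ i ⟧ ⟨
    ⟦ i ⟧ * (⟦ opposite (π ⟨$⟩ʳ i) ⟧ + ⟦ π ⟨$⟩ʳ i ⟧)       ≡⟨ cong (⟦ i ⟧ *_) (index-opposite (π ⟨$⟩ʳ i)) ⟩
    ⟦ i ⟧ * suc n                                          ≡⟨ *-comm ⟦ i ⟧ (suc n) ⟩
    suc n * ⟦ i ⟧                                          ∎

-- prependMax π is the permutation (n+1) π(1) ⋯ π(n).
prependMax : ∀ {n} → Permutation′ n → Permutation′ (suc n)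
prependMax = complement ∘ lift₀ ∘ complement

cosine-prependMax : ∀ {n} (π : Permutation′ n) → cosine (prependMax π) ≡ cosine π + triangle (suc n)
cosine-prependMax {n} π = +-cancelʳ-≡ (cosine ρ) _ _ (begin
  cosine (complement ρ) + cosine ρ
    ≡⟨ cosine-complement ρ ⟩
  suc (suc n) * triangle (suc n)
    ≡⟨ cong (triangle (suc n) +_) (*-distribˡ-+ (suc n) (triangle n) (suc n)) ⟩
  triangle (suc n) + (suc n * triangle n + suc n * suc n)
    ≡⟨ cong (λ x → triangle (suc n) + (x + suc n * suc n)) (cosine-complement π) ⟨
  triangle (suc n) + ((cosine (complement π) + cosine π) + suc n * suc n)
    ≡⟨ regroup (triangle (suc n)) (cosine (complement π)) (cosine π) (suc n * suc n) ⟩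
  (cosine π + triangle (suc n)) + (cosine (complement π) + suc n * suc n)
    ≡⟨ cong (cosine π + triangle (suc n) +_) (cosine-lift₀ (complement π)) ⟨
  (cosine π + triangle (suc n)) + cosine ρ
    ∎)
  where
  open ≡-Reasoning
  ρ : Permutation′ (suc n)
  ρ = lift₀ (complement π)
  regroup : ∀ t c′ c s → t + ((c′ + c) + s) ≡ (c + t) + (c′ + s)
  regroup = solve-∀

Achievable : ℕ → ℕ → Set
Achievable n k = Σ (Permutation′ n) λ π → cosine π ≡ k

Covers : ℕ → ℕ → ℕ → Set
Covers n l h = ∀ {k} → l ≤ k → k ≤ h → Achievable n k

covers-shift : ∀ {m n l h} d (f : Permutation′ n → Permutation′ m) →
               (∀ π → cosine (f π) ≡ cosine π + d) → Covers n l h → Covers m (l + d) (h + d)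
covers-shift {l = l} {h} d f cosine-f covers {k} l+d≤k k≤h+d
  with π , cosine-π ← covers (m+n≤o⇒m≤o∸n l l+d≤k) (m≤n+o⇒m∸n≤o k d (≤-trans k≤h+d (≤-reflexive (+-comm h d))))
  = f π , (begin
    cosine (f π) ≡⟨ cosine-f π ⟩
    cosine π + d ≡⟨ cong (_+ d) cosine-π ⟩
    k ∸ d + d    ≡⟨ m∸n+n≡m (m+n≤o⇒n≤o l l+d≤k) ⟩
    k            ∎)
  where open ≡-Reasoning

covers-suc : ∀ {n l h} → Covers n l h → l + triangle n ≤ suc h →
             Covers (suc n) (l + triangle (suc n)) (h + suc n * suc n)
covers-suc {n} {l} {h} covers gap {k} l+T≤k k≤h+sq with l + suc n * suc n ≤? k
... | yes l+sq≤k = covers-shift _ lift₀ cosine-lift₀ covers l+sq≤k k≤h+sq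
... | no  l+sq≰k = covers-shift _ prependMax cosine-prependMax covers l+T≤k (s≤s⁻¹ (begin-strict
  k                                   <⟨ ≰⇒> l+sq≰k ⟩
  l + suc n * suc n                   ≡⟨ cong (l +_) (triangle-square n) ⟨
  l + (triangle n + triangle (suc n)) ≡⟨ +-assoc l (triangle n) (triangle (suc n)) ⟨
  l + triangle n + triangle (suc n)   ≤⟨ +-monoˡ-≤ (triangle (suc n)) gap ⟩
  suc h + triangle (suc n)            ∎))
  where open ≤-Reasoning

rank-4-witnesses : All (Achievable 4) (applyUpTo (20 +_) 11)
rank-4-witnesses = (transpose 0F 3F ∘ₚ transpose 1F 2F , refl)
       ∷ (transpose 0F 3F , refl)
       ∷ (transpose 0F 2F ∘ₚ transpose 1F 3F , refl)
       ∷ (transpose 0F 1F ∘ₚ transpose 0F 3F , refl)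
       ∷ (transpose 0F 1F ∘ₚ transpose 0F 2F ∘ₚ transpose 0F 3F , refl)
       ∷ (transpose 0F 1F ∘ₚ transpose 0F 2F ∘ₚ transpose 2F 3F , refl)
       ∷ (transpose 0F 2F , refl)
       ∷ (transpose 0F 1F ∘ₚ transpose 0F 2F , refl)
       ∷ (transpose 0F 1F ∘ₚ transpose 2F 3F , refl)
       ∷ (transpose 0F 1F , refl)
       ∷ (id , refl)
       ∷ []

covers-rank-4 : Covers 4 20 30
covers-rank-4 {k} 20≤k k≤30 =
  subst (Achievable 4) (m+[n∸m]≡n 20≤k) (applyUpTo⁻ (20 +_) 11 rank-4-witnesses (s≤s (∸-monoˡ-≤ 20 k≤30)))

2+n≤triangle : ∀ m → 2 + (3 + m) ≤ triangle (3 + m)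
2+n≤triangle m = +-monoˡ-≤ (3 + m) (≤-trans (m≤m+n 2 m) (m≤n+m (2 + m) (triangle (1 + m))))

tetrahedral-suc≤suc-squarePyramidal-step :
  ∀ {n} → 2 + n ≤ triangle n → tetrahedral (suc n) ≤ suc (squarePyramidal n) →
  tetrahedral (2 + n) ≤ suc (squarePyramidal (suc n))
tetrahedral-suc≤suc-squarePyramidal-step {n} n+2≤T previous = begin
  tetrahedral (suc n) + triangle (2 + n)        ≤⟨ +-monoˡ-≤ (triangle (2 + n)) previous ⟩
  suc (squarePyramidal n) + (triangle (suc n) + (2 + n))
    ≤⟨ +-monoʳ-≤ (suc (squarePyramidal n)) (+-monoʳ-≤ (triangle (suc n)) n+2≤T) ⟩
  suc (squarePyramidal n) + (triangle (suc n) + triangle n)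
    ≡⟨ cong (suc (squarePyramidal n) +_) (trans (+-comm (triangle (suc n)) (triangle n)) (triangle-square n)) ⟩
  suc (squarePyramidal n) + suc n * suc n       ∎
  where open ≤-Reasoning

tetrahedral-suc≤suc-squarePyramidal : ∀ m → tetrahedral (6 + m) ≤ suc (squarePyramidal (5 + m))
tetrahedral-suc≤suc-squarePyramidal zero    = ≤-refl
tetrahedral-suc≤suc-squarePyramidal (suc m) =
  tetrahedral-suc≤suc-squarePyramidal-step (2+n≤triangle (2 + m)) (tetrahedral-suc≤suc-squarePyramidal m)

covers-from-5 : ∀ m → Covers (5 + m) (tetrahedral (5 + m)) (squarePyramidal (5 + m))
covers-from-5 zero    = covers-suc covers-rank-4 (n≤1+n 30)
covers-from-5 (suc m) = covers-suc (covers-from-5 m)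
  (≤-trans (+-monoʳ-≤ (tetrahedral (5 + m)) (m≤m+n (triangle (5 + m)) (6 + m))) (tetrahedral-suc≤suc-squarePyramidal m))

interval-chain : (l h : ℕ → ℕ) → (∀ i → l (suc i) ≤ suc (h i)) →
                 ∀ {k} m → l 0 ≤ k → k ≤ h m → ∃[ i ] (l i ≤ k × k ≤ h i)
interval-chain l h chain zero        l₀≤k k≤hₘ = 0 , l₀≤k , k≤hₘ
interval-chain l h chain {k} (suc m) l₀≤k k≤hₘ with k ≤? h m
... | yes k≤h = interval-chain l h chain m l₀≤k k≤h
... | no  k≰h = suc m , ≤-trans (chain m) (≰⇒> k≰h) , k≤hₘ

n≤squarePyramidal : ∀ n → n ≤ squarePyramidal n
n≤squarePyramidal zero    = z≤n
n≤squarePyramidal (suc n) = ≤-trans (m≤m*n (suc n) (suc n)) (m≤n+m _ (squarePyramidal n))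

large-values : ∀ {k} → 35 ≤ k → ∃[ n ] (n ≥ 1 × Achievable n k)
large-values {k} 35≤k
  with interval-chain (tetrahedral ∘ (5 +_)) (squarePyramidal ∘ (5 +_)) tetrahedral-suc≤suc-squarePyramidal
                      k 35≤k (≤-trans (m≤n+m k 5) (n≤squarePyramidal (5 + k)))
... | i , lo≤k , k≤hi = 5 + i , s≤s z≤n , covers-from-5 i lo≤k k≤hi

Claim : ℕ → Set
Claim k = k ≥ 1 → ¬ Exceptional k → ∃[ n ] (n ≥ 1 × Achievable n k)

achieved : ∀ n .{{_ : NonZero n}} {k} → Achievable n k → Claim k
achieved n a _ _ = n , >-nonZero⁻¹ n , a

excluded : ∀ {k} → Exceptional k → Claim k
excluded e _ ¬e = ⊥-elim (¬e e)

small-values : All Claim (upTo 35)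
small-values = ++⁺ below-20 (++⁺ (All.map (achieved 4) rank-4-witnesses) from-31)
  where
  below-20 : All Claim (upTo 20)
  below-20 = (λ ()) ∷ achieved 1 (id , refl) ∷ excluded e2 ∷ excluded e3
           ∷ achieved 2 (transpose 0F 1F , refl) ∷ achieved 2 (id , refl)
           ∷ excluded e6 ∷ excluded e7 ∷ excluded e8 ∷ excluded e9
           ∷ achieved 3 (transpose 0F 2F , refl) ∷ achieved 3 (transpose 0F 1F ∘ₚ transpose 0F 2F , refl)
           ∷ excluded e12 ∷ achieved 3 (transpose 0F 1F , refl) ∷ achieved 3 (id , refl)
           ∷ excluded e15 ∷ excluded e16 ∷ excluded e17 ∷ excluded e18 ∷ excluded e19 ∷ []
  from-31 : All Claim (applyUpTo (31 +_) 4)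
  from-31 = excluded e31 ∷ excluded e32 ∷ excluded e33 ∷ excluded e34 ∷ []

theorem2p2 : (k : ℕ) → k ≥ 1 → ¬ Exceptional k →
    Σ ℕ (λ n → n ≥ 1 × Σ (Permutation′ n) (λ π → cosine π ≡ k))
theorem2p2 k k≥1 ¬exceptional with 35 ≤? k
... | yes 35≤k = large-values 35≤k
... | no  35≰k = applyUpTo⁻ (λ i → i) 35 small-values (≰⇒> 35≰k) k≥1 ¬exceptional
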